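{- For every strongly connected simple directed graph $G$, the period of the asynchronous maximum model on $G$ is $1$; that is, every absorbing component of the Markov chain of possibilities of $G$ consists of a single valuation.
   Context: Let $G=(V,E)$ be a finite simple directed graph with $n=|V|$ vertices and $[n]=\{1,\dots,n\}$. A valuation is a function $f:V\to[n]$. The asynchronous maximum model: given $f_t$, choose $v'\in V$ uniformly at random; set $f_{t+1}(v')=\max\{f_t(u): u\neq v',\ (v',u)\in E\}$ if $v'$ has an out-neighbour (unchanged otherwise), and $f_{t+1}(v)=f_t(v)$ for $v\neq v'$. The Markov chain of possibilities is the directed graph (loops allowed) whose vertices are all valuations $V\to[n]$, with an edge $f\to g$ whenever the one-round transition probability from $f$ to $g$ is positive. Its absorbing components are the maximal strongly connected components with no edge leaving them, and the period of $G$ is the maximum number of valuations in an absorbing component. -}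

module Defs where

open import Data.Nat using (ℕ)
open import Data.Fin using (Fin; _≤_)
open import Data.Vec using (Vec; lookup)
open import Data.Product using (Σ; ∃; _×_; _,_)
open import Data.Sum using (_⊎_)
open import Relation.Nullary using (¬_)
open import Relation.Binary.PropositionalEquality using (_≡_)
open import Relation.Binary.Construct.Closure.ReflexiveTransitive using (Star)

record Digraph (n : ℕ) : Set₁ where
  field
    Edge     : Fin n → Fin n → Set
    loopless : ∀ v → ¬ Edge v v
open Digraph public

StronglyConnected : ∀ {n} → Digraph n → Set
StronglyConnected {n} G = ∀ (u v : Fin n) → Star (Edge G) u v

-- Valuations f : V → [n]; the value set [n] = {1,…,n} is encoded as Fin n
-- (i ↦ i+1, order preserving). A valuation is stored as a vector so that
-- equality of valuations is propositional equality.
Valuation : ℕ → Set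
Valuation n = Vec (Fin n) n

IsNbrMax : ∀ {n} → Digraph n → Valuation n → Fin n → Fin n → Set
IsNbrMax {n} G f v m =
  (∃ λ (u : Fin n) → ¬ (u ≡ v) × Edge G v u × lookup f u ≡ m) ×
  (∀ (u : Fin n) → ¬ (u ≡ v) → Edge G v u → lookup f u ≤ m)

HasOutNbr : ∀ {n} → Digraph n → Fin n → Set
HasOutNbr {n} G v = ∃ λ (u : Fin n) → ¬ (u ≡ v) × Edge G v u

Update : ∀ {n} → Digraph n → Valuation n → Fin n → Valuation n → Set
Update {n} G f v g =
  (∀ (w : Fin n) → ¬ (w ≡ v) → lookup g w ≡ lookup f w) ×
  ((HasOutNbr G v × IsNbrMax G f v (lookup g v)) ⊎
   (¬ HasOutNbr G v × lookup g v ≡ lookup f v))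

-- Edge f → g of the Markov chain of possibilities: the one-round transition
-- probability is positive, i.e. some vertex v (chosen with probability 1/n > 0)
-- yields g when updated.
Step : ∀ {n} → Digraph n → Valuation n → Valuation n → Set
Step {n} G f g = ∃ λ (v : Fin n) → Update G f v g

Reach : ∀ {n} → Digraph n → Valuation n → Valuation n → Set
Reach G = Star (Step G)

record IsAbsorbingComponent {n} (G : Digraph n) (C : Valuation n → Set) : Set where
  field
    nonempty    : ∃ λ f → C f
    connected   : ∀ f g → C f → C g → Reach G f g
    maximal     : ∀ f g → C f → Reach G f g → Reach G g f → C g
    noExit      : ∀ f g → C f → Step G f g → C g

-- An update only copies a value that is already present, so a maximal value M of a
-- valuation f bounds everything reachable from f. Updating a vertex v with an
-- out-neighbour at value M therefore sets v to M; following, for every vertex v, a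
-- path from v to a vertex at M backwards spreads M over the whole graph, so the
-- constant valuation M is reachable from f. That valuation is fixed by every step,
-- hence an absorbing component containing f consists of it alone.
module Submission where

open import Defs
open import Data.Nat using (ℕ; zero; suc)
open import Data.Fin using (Fin; _≤_; _≟_) renaming (zero to fzero)
open import Data.Fin.Properties using (≤-totalOrder)
open import Data.Vec using (Vec; []; lookup; replicate; _[_]≔_)
open import Data.Vec.Properties using (lookup∘update; lookup∘update′; lookup-replicate)
open import Data.Vec.Relation.Binary.Pointwise.Extensional using (ext; Pointwise-≡⇒≡)
open import Data.List using (List; []; _∷_; allFin)
open import Data.List.Relation.Unary.All using (All; []; _∷_)
import Data.List.Relation.Unary.All as All
open import Data.List.Membership.Propositional.Properties using (∈-allFin)
open import Data.Product using (∃; _×_; _,_)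
open import Data.Sum using (inj₁; inj₂)
open import Function using (id; _∘_)
open import Relation.Nullary using (yes; no)
open import Relation.Unary using (_⊆_)
open import Relation.Binary.PropositionalEquality using (_≡_; _≢_; refl; sym; trans; subst)
open import Relation.Binary.Construct.Closure.ReflexiveTransitive using (Star; ε; _◅_; _◅◅_)

Star-fixed : ∀ {A : Set} {R : A → A → Set} {x y : A} →
             (∀ {z} → R x z → z ≡ x) → Star R x y → y ≡ x
Star-fixed fixed ε            = refl
Star-fixed fixed (x→z ◅ z→*y) with fixed x→z
... | refl = Star-fixed fixed z→*y

max-position : ∀ {m k} (f : Vec (Fin m) (suc k)) → ∃ λ w → ∀ u → lookup f u ≤ lookup f w
max-position {m} {k} f = argmax (lookup f) fzero positions , λ u →
  All.lookup (f[xs]≤f[argmax] {f = lookup f} fzero positions) (∈-allFin u)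
  where
  open import Data.List.Extrema (≤-totalOrder m) using (argmax; f[xs]≤f[argmax])
  positions : List (Fin (suc k))
  positions = allFin (suc k)

BoundedBy : ∀ {n} → Fin n → Valuation n → Set
BoundedBy M f = ∀ u → lookup f u ≤ M

module _ {n : ℕ} (G : Digraph n) where

  step-copies : ∀ {f g} → Step G f g → ∀ u → ∃ λ x → lookup g u ≡ lookup f x
  step-copies (v , unchanged , updated) u with u ≟ v
  ... | no u≢v = u , unchanged u u≢v
  ... | yes refl with updated
  ...   | inj₁ (_ , (x , _ , _ , fx≡gv) , _) = x , sym fx≡gv
  ...   | inj₂ (_ , gv≡fv)                   = u , gv≡fv

  reach-bounded : ∀ M {f g} → Reach G f g → BoundedBy M f → BoundedBy M g
  reach-bounded M ε                          f≤M = f≤M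
  reach-bounded M (_◅_ {i = f} {j = h} f→h h→*g) f≤M = reach-bounded M h→*g λ u →
    let x , hu≡fx = step-copies {f} {h} f→h u in subst (_≤ M) (sym hu≡fx) (f≤M x)

  constant-fixed : ∀ {M g} → Step G (replicate n M) g → g ≡ replicate n M
  constant-fixed {M} {g} c→g = Pointwise-≡⇒≡ (ext λ u →
    let x , gu≡Mx = step-copies {replicate n M} {g} c→g u
    in trans gu≡Mx (trans (lookup-replicate x M) (sym (lookup-replicate u M))))

module _ {n : ℕ} {G : Digraph n} where

  absorbing-closed : ∀ {C} → IsAbsorbingComponent G C → ∀ {f g} → Reach G f g → C f → C g
  absorbing-closed C-abs ε             f∈C = f∈C
  absorbing-closed C-abs (f→h ◅ h→*g) f∈C =
    absorbing-closed C-abs h→*g (IsAbsorbingComponent.noExit C-abs _ _ f∈C f→h)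

  absorbing-fixed-singleton : ∀ {C f} → IsAbsorbingComponent G C → C f →
                              (∀ {g} → Step G f g → g ≡ f) → ∀ g → C g → g ≡ f
  absorbing-fixed-singleton C-abs f∈C fixed g g∈C =
    Star-fixed fixed (IsAbsorbingComponent.connected C-abs _ g f∈C g∈C)

module Spread {n : ℕ} (G : Digraph n) (M : Fin n) where

  AtMax : Valuation n → Fin n → Set
  AtMax f u = lookup f u ≡ M

  raise-step : ∀ f {v u} → BoundedBy M f → Edge G v u → AtMax f u → Step G f (f [ v ]≔ M)
  raise-step f {v} {u} f≤M v→u fu≡M =
    v , (λ w w≢v → lookup∘update′ w≢v f M) ,
    inj₁ ((u , u≢v , v→u) ,
          (u , u≢v , v→u , trans fu≡M (sym (lookup∘update v f M))) ,
          λ x _ _ → subst (lookup f x ≤_) (sym (lookup∘update v f M)) (f≤M x))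
    where
    u≢v : u ≢ v
    u≢v refl = loopless G u v→u

  raise-⊆ : ∀ f v → AtMax f ⊆ AtMax (f [ v ]≔ M)
  raise-⊆ f v {u} fu≡M with u ≟ v
  ... | yes refl = lookup∘update v f M
  ... | no u≢v   = trans (lookup∘update′ u≢v f M) fu≡M

  raise-along : ∀ {v w} f → Star (Edge G) v w → BoundedBy M f → AtMax f w →
                ∃ λ g → Reach G f g × AtMax f ⊆ AtMax g × AtMax g v
  raise-along f ε f≤M fw≡M = _ , ε , id , fw≡M
  raise-along {v} f (v→x ◅ x→*w) f≤M fw≡M with raise-along f x→*w f≤M fw≡M
  ... | g , f→*g , f⊆g , gx≡M =
    g [ v ]≔ M , f→*g ◅◅ (raise-step g (reach-bounded G M f→*g f≤M) v→x gx≡M ◅ ε) ,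
    raise-⊆ g v ∘ f⊆g , lookup∘update v g M

  raise-all : StronglyConnected G → ∀ {w} f → BoundedBy M f → AtMax f w → ∀ vs →
              ∃ λ g → Reach G f g × AtMax f ⊆ AtMax g × All (AtMax g) vs
  raise-all sc f f≤M fw≡M [] = _ , ε , id , []
  raise-all sc {w} f f≤M fw≡M (v ∷ vs) with raise-along f (sc v w) f≤M fw≡M
  ... | g , f→*g , f⊆g , gv≡M with raise-all sc g (reach-bounded G M f→*g f≤M) (f⊆g fw≡M) vs
  ...   | h , g→*h , g⊆h , vs⊆h =
    h , f→*g ◅◅ g→*h , g⊆h ∘ f⊆g , g⊆h gv≡M ∷ vs⊆h

  reach-constant : StronglyConnected G → ∀ {w} f → BoundedBy M f → AtMax f w →
                   Reach G f (replicate n M)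
  reach-constant sc f f≤M fw≡M with raise-all sc f f≤M fw≡M (allFin n)
  ... | g , f→*g , _ , all≡M = subst (Reach G f) g≡c f→*g
    where
    g≡c : g ≡ replicate n M
    g≡c = Pointwise-≡⇒≡ (ext λ u →
      trans (All.lookup all≡M (∈-allFin u)) (sym (lookup-replicate u M)))

mainTheorem12 : ∀ (n : ℕ) (G : Digraph n) → StronglyConnected G →
    ∀ (C : Valuation n → Set) → IsAbsorbingComponent G C →
      ∃ λ (f : Valuation n) → C f × (∀ (g : Valuation n) → C g → g ≡ f)
mainTheorem12 zero G sc C C-abs with IsAbsorbingComponent.nonempty C-abs
... | [] , f∈C = [] , f∈C , λ { [] _ → refl }
mainTheorem12 (suc k) G sc C C-abs with IsAbsorbingComponent.nonempty C-abs
... | f , f∈C with max-position f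
...   | w , f≤fw = c , c∈C , absorbing-fixed-singleton C-abs c∈C (constant-fixed G)
  where
  c : Valuation (suc k)
  c = replicate (suc k) (lookup f w)
  c∈C : C c
  c∈C = absorbing-closed C-abs (Spread.reach-constant G (lookup f w) sc f f≤fw refl) f∈C
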